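{- Let $k \ge 2$ and let $A \subset \mathbb{Z}_k$ be a near arithmetic progression. Then at least one of the following holds: (1) there exists a proper divisor $d > 1$ of $k$ such that for every subset $A' \subset A$ with $|A'| = |A|-1$ and every $x \in \mathbb{Z}_k$, if $A'+x \subseteq A$ then $x$ is a multiple of $d$; (2) there exists $a \in \mathbb{Z}_k$ with $\gcd(a,k) = 1$ such that for every subset $A' \subset A$ with $|A'| = |A|-1$ and every $x \in \mathbb{Z}_k$, if $A'+x \subseteq A$ then $x \in \{0,a,-a\}$.
   Context: For $A \subseteq \mathbb{Z}_k$ and $a \in \mathbb{Z}_k$, $A+a = \{s+a : s \in A\}$. A set $A \subset \mathbb{Z}_k$ is a near arithmetic progression if $2 \le |A| \le k-2$ and there exist a subset $B \subset A$ with $|B| = |A|-1$ and a nonzero $a \in \mathbb{Z}_k$ such that $B+a \subseteq A$. For a divisor $d$ of $k$, an element of $\mathbb{Z}_k$ is a multiple of $d$ if it is congruent to $0$ modulo $d$ (well defined since $d \mid k$). -}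

module Defs where

open import Data.Nat using (ℕ; suc; _+_; _∸_; _≤_; _<_; NonZero)
open import Data.Nat.DivMod using (_%_; m%n<n)
open import Data.Fin using (Fin; toℕ; fromℕ<)
open import Data.Fin.Subset using (Subset; _∈_; _⊆_; ∣_∣)
open import Data.Product using (Σ; ∃; _×_; _,_)
open import Relation.Binary.PropositionalEquality using (_≡_)
open import Relation.Nullary using (¬_)

-- ℤ_k is modelled as Fin k (elements 0..k-1); k ≥ 1 supplied via NonZero.

_+ₖ_ : ∀ {k} .{{_ : NonZero k}} → Fin k → Fin k → Fin k
_+ₖ_ {k} a b = fromℕ< (m%n<n (toℕ a + toℕ b) k)

-ₖ_ : ∀ {k} .{{_ : NonZero k}} → Fin k → Fin k
-ₖ_ {k} a = fromℕ< (m%n<n (k ∸ toℕ a) k)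

0ₖ : ∀ {k} .{{_ : NonZero k}} → Fin k
0ₖ {k} = fromℕ< (m%n<n 0 k)

TranslateInto : ∀ {k} .{{_ : NonZero k}} → Subset k → Fin k → Subset k → Set
TranslateInto B a A = ∀ {s} → s ∈ B → (s +ₖ a) ∈ A

NearAP : ∀ {k} .{{_ : NonZero k}} → Subset k → Set
NearAP {k} A =
  2 ≤ ∣ A ∣ × suc (suc ∣ A ∣) ≤ k ×
  Σ (Subset k) λ B → Σ (Fin k) λ a →
    B ⊆ A × suc ∣ B ∣ ≡ ∣ A ∣ × ¬ (a ≡ 0ₖ) × TranslateInto B a A

module Submission where

-- Call v an almost period of A when at most one point of A leaves A under the shift by v; the
-- hypothesis A′ + x ⊆ A with |A′| = |A| - 1 makes x one, and the near arithmetic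
-- progression A has a nonzero almost period a. Since shifting preserves |A|, an almost period
-- also has at most one point entering A.
--
-- If every almost period lies in {0, a, -a}, then either gcd (a, k) = 1 or d = gcd (a, k) is a
-- proper divisor of k dividing 0, a and -a. Otherwise pick an almost period y outside {0, a, -a}.
-- If a is a period of A, every almost period is a period (an escape e of v would be moved by the
-- period a to a second escape e + a). If not, let w ∈ {a, y} with 2w ≠ 0 and let e be its escape:
-- comparing with the escape of the other one shows that the w-progression ending at e is just {e},
-- or that the gap after e is just {e + w}. Removing e, respectively adding e + w, gives a proper
-- nonempty set X with period w, and a short orbit argument makes every almost period of A a period
-- of X. The least positive period of X is then the proper divisor of k required by (1).

open import Defs
open import Data.Nat
  using (ℕ; zero; suc; _+_; _*_; _∸_; _≤_; _<_; NonZero; z≤n; s≤s; s≤s⁻¹; >-nonZero⁻¹; >-nonZero; ≢-nonZero⁻¹)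
import Data.Nat as ℕ
open import Data.Nat.Properties hiding (_≟_; suc-injective)
open import Data.Nat.DivMod
  using (_/_; _%_; _mod_; m≡m%n+[m/n]*n; m%n<n; m%n%n≡m%n; %-distribˡ-+; n%n≡0; m<n⇒m%n≡m; [m+n]%n≡m%n)
open import Data.Nat.Divisibility using (_∣_; m%n≡0⇒n∣m; _∣0; ∣⇒≤; ∣m+n∣m⇒∣n; %-presˡ-∣)
open import Data.Nat.GCD using (gcd; gcd[m,n]∣m; gcd[m,n]∣n; gcd[m,n]≡0⇒n≡0)
open import Data.Nat.Induction using (<-rec)
open import Data.Bool using (Bool; true; false; _∧_; not; if_then_else_)
import Data.Bool as Bool
open import Data.Bool.Properties using (∧-comm)
open import Data.Fin using (Fin; toℕ; zero; suc)
open import Data.Fin.Properties using (toℕ-fromℕ<; toℕ-injective; toℕ<n; any?; all?; _≟_; suc-injective)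
open import Data.Fin.Permutation using (permutation)
open import Data.Fin.Subset using (Subset; ∣_∣; _∈_; _∉_; _⊆_; _⊂_; _-_; ∁)
open import Data.Fin.Subset.Properties using (x∈p∧x≢y⇒x∈p-y; x∈p⇒∣p-x∣<∣p∣; p⊂q⇒∣p∣<∣q∣; ∣∁p∣≡n∸∣p∣)
open import Data.Vec using ([]; _∷_; lookup)
open import Data.Vec.Properties using ([]=⇒lookup; lookup⇒[]=; lookup-map)
open import Data.Vec.Functional using (updateAt)
open import Data.Vec.Functional.Properties using (updateAt-updates; updateAt-minimal)
open import Data.Product using (Σ; ∃; _×_; _,_)
open import Data.Sum using (_⊎_; inj₁; inj₂)
import Data.Sum as Sum
open import Data.Empty using (⊥; ⊥-elim)
open import Function using (_∘_)
open import Relation.Nullary using (¬_; Dec; yes; no; contradiction)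
open import Relation.Nullary.Decidable using (¬?; _×-dec_; _⊎-dec_; map′)
open import Relation.Unary using (Pred; Decidable)
open import Relation.Binary.PropositionalEquality
open import Relation.Binary.Definitions using (tri<; tri≈; tri>)
open import Algebra.Properties.CommutativeMonoid.Sum +-0-commutativeMonoid
  using (sum; sum-cong-≗; ∑-distrib-+; ∑-permute)

minimal-witness : ∀ {p} {P : Pred ℕ p} → Decidable P → ∀ {n} → P n →
                  Σ ℕ λ m → P m × (∀ {j} → j < m → ¬ P j)
minimal-witness {P = P} P? {n} = <-rec (λ n → P n → Least) step n
  where
    Least = Σ ℕ λ m → P m × (∀ {j} → j < m → ¬ P j)
    step : ∀ n → (∀ {j} → j < n → P j → Least) → P n → Least
    step n smaller pn with anyUpTo? P? n
    ... | yes (j , j<n , pj) = smaller j<n pj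
    ... | no none = n , pn , λ j<n pj → none (_ , j<n , pj)

x+x-injective : ∀ {x y} → x + x ≡ y + y → x ≡ y
x+x-injective {x} {y} eq with <-cmp x y
... | tri< x<y _ _ = contradiction eq (<⇒≢ (+-mono-< x<y x<y))
... | tri≈ _ x≡y _ = x≡y
... | tri> _ _ x>y = contradiction (sym eq) (<⇒≢ (+-mono-< x>y x>y))

∧-not≡true⇒ : ∀ {x y} → x ∧ not y ≡ true → x ≡ true × y ≡ false
∧-not≡true⇒ {true} {false} _ = refl , refl

not≡true⇒≡false : ∀ {x} → not x ≡ true → x ≡ false
not≡true⇒≡false {false} _ = refl

∧-not≡true : ∀ {x y} → x ≡ true → y ≡ false → x ∧ not y ≡ true
∧-not≡true refl refl = refl

-- Counting

count : ∀ {n} → (Fin n → Bool) → ℕ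
count f = sum λ i → if f i then 1 else 0

AtMostOne : ∀ {n} → (Fin n → Bool) → Set
AtMostOne f = ∀ {i j} → f i ≡ true → f j ≡ true → i ≡ j

count-cong : ∀ {n} {f g : Fin n → Bool} → (∀ i → f i ≡ g i) → count f ≡ count g
count-cong f≗g = sum-cong-≗ λ i → cong (if_then 1 else 0) (f≗g i)

count-true : ∀ {n} (f : Fin n → Bool) {i} → f i ≡ true → 0 < count f
count-true f {zero} fi rewrite fi = s≤s z≤n
count-true f {suc i} fi = ≤-trans (count-true (f ∘ suc) fi) (m≤n+m _ _)

count-false : ∀ {n} (f : Fin n → Bool) → (∀ i → f i ≡ false) → count f ≡ 0
count-false {zero} f _ = refl
count-false {suc n} f none rewrite none zero = count-false (f ∘ suc) (none ∘ suc)

count-split : ∀ {n} (f g : Fin n → Bool) →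
              count f ≡ count (λ i → f i ∧ g i) + count (λ i → f i ∧ not (g i))
count-split f g = trans (sum-cong-≗ λ i → split (f i) (g i))
  (∑-distrib-+ (λ i → if f i ∧ g i then 1 else 0) (λ i → if f i ∧ not (g i) then 1 else 0))
  where
    split : ∀ x y → (if x then 1 else 0) ≡ (if x ∧ y then 1 else 0) + (if x ∧ not y then 1 else 0)
    split false _ = refl
    split true false = refl
    split true true = refl

count≤1⇒AtMostOne : ∀ {n} (f : Fin n → Bool) → count f ≤ 1 → AtMostOne f
count≤1⇒AtMostOne f c {zero} {zero} _ _ = refl
count≤1⇒AtMostOne f c {zero} {suc j} fi fj rewrite fi =
  contradiction (≤-trans (count-true (f ∘ suc) fj) (s≤s⁻¹ c)) λ ()
count≤1⇒AtMostOne f c {suc i} {zero} fi fj = sym (count≤1⇒AtMostOne f c fj fi)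
count≤1⇒AtMostOne f c {suc i} {suc j} fi fj =
  cong suc (count≤1⇒AtMostOne (f ∘ suc) (≤-trans (m≤n+m _ _) c) fi fj)

AtMostOne⇒count≤1 : ∀ {n} (f : Fin n → Bool) → AtMostOne f → count f ≤ 1
AtMostOne⇒count≤1 {zero} f _ = z≤n
AtMostOne⇒count≤1 {suc n} f unique with f zero in f0
... | false = AtMostOne⇒count≤1 (f ∘ suc) λ fi fj → suc-injective (unique fi fj)
... | true = ≤-reflexive (cong suc (count-false (f ∘ suc) only-zero))
  where
    only-zero : ∀ i → f (suc i) ≡ false
    only-zero i with f (suc i) in fi
    ... | false = refl
    ... | true with () ← unique f0 fi

2≤count⇒other : ∀ {n} (f : Fin n → Bool) → 2 ≤ count f → ∀ p → ∃ λ t → t ≢ p × f t ≡ true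
2≤count⇒other f 2≤count p with any? (λ t → ¬? (t ≟ p) ×-dec (f t Bool.≟ true))
... | yes other = other
... | no none = contradiction (AtMostOne⇒count≤1 f λ fi fj → trans (at-p fi) (sym (at-p fj))) (<⇒≱ 2≤count)
  where
    at-p : ∀ {i} → f i ≡ true → i ≡ p
    at-p {i} fi with i ≟ p
    ... | yes i≡p = i≡p
    ... | no i≢p = contradiction (i , i≢p , fi) none

count-lookup : ∀ {n} (A : Subset n) → count (lookup A) ≡ ∣ A ∣
count-lookup [] = refl
count-lookup (true ∷ A) = cong suc (count-lookup A)
count-lookup (false ∷ A) = count-lookup A

count-∁ : ∀ {n} (A : Subset n) → count (not ∘ lookup A) ≡ n ∸ ∣ A ∣
count-∁ A = trans (count-cong λ i → sym (lookup-map i not A)) (trans (count-lookup (∁ A)) (∣∁p∣≡n∸∣p∣ A))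

module _ {k : ℕ} .{{_ : NonZero k}} where

  -- Arithmetic in ℤ_k

  infixl 6 _⊕_
  infix 4 _≡ₖ_ _≢ₖ_

  -- Shifting by natural numbers; s +ₖ x from Defs is s ⊕ toℕ x by definition.
  _⊕_ : Fin k → ℕ → Fin k
  s ⊕ n = (toℕ s + n) mod k

  _≡ₖ_ _≢ₖ_ : ℕ → ℕ → Set
  m ≡ₖ n = m % k ≡ n % k
  m ≢ₖ n = ¬ (m ≡ₖ n)

  neg : ℕ → ℕ
  neg n = k ∸ n % k

  0%k≡0 : 0 % k ≡ 0
  0%k≡0 = m<n⇒m%n≡m (>-nonZero⁻¹ k)

  %-≡ₖ : ∀ n → n % k ≡ₖ n
  %-≡ₖ n = m%n%n≡m%n n k

  +-congˡ-≡ₖ : ∀ m {n n′} → n ≡ₖ n′ → m + n ≡ₖ m + n′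
  +-congˡ-≡ₖ m {n} {n′} n≡n′ = begin
    (m + n) % k           ≡⟨ %-distribˡ-+ m n k ⟩
    (m % k + n % k) % k   ≡⟨ cong (λ r → (m % k + r) % k) n≡n′ ⟩
    (m % k + n′ % k) % k  ≡⟨ %-distribˡ-+ m n′ k ⟨
    (m + n′) % k          ∎
    where open ≡-Reasoning

  +-congʳ-≡ₖ : ∀ {m m′} n → m ≡ₖ m′ → m + n ≡ₖ m′ + n
  +-congʳ-≡ₖ {m} {m′} n m≡m′ =
    trans (cong (_% k) (+-comm m n)) (trans (+-congˡ-≡ₖ n m≡m′) (cong (_% k) (+-comm n m′)))

  +-inverseʳ-≡ₖ : ∀ n → n + neg n ≡ₖ 0
  +-inverseʳ-≡ₖ n = begin
    (n + (k ∸ n % k)) % k      ≡⟨ +-congʳ-≡ₖ (k ∸ n % k) (%-≡ₖ n) ⟨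
    (n % k + (k ∸ n % k)) % k  ≡⟨ cong (_% k) (m+[n∸m]≡n (<⇒≤ (m%n<n n k))) ⟩
    k % k                      ≡⟨ n%n≡0 k ⟩
    0                          ≡⟨ 0%k≡0 ⟨
    0 % k                      ∎
    where open ≡-Reasoning

  +-identityˡ-≡ₖ : ∀ {z} n → z ≡ₖ 0 → z + n ≡ₖ n
  +-identityˡ-≡ₖ n z≡0 = +-congʳ-≡ₖ n z≡0

  +-inverseˡ-≡ₖ : ∀ n → neg n + n ≡ₖ 0
  +-inverseˡ-≡ₖ n = trans (cong (_% k) (+-comm (neg n) n)) (+-inverseʳ-≡ₖ n)

  neg-cancelˡ-≡ₖ : ∀ m n → neg m + (m + n) ≡ₖ n
  neg-cancelˡ-≡ₖ m n = trans (cong (_% k) (sym (+-assoc (neg m) m n))) (+-identityˡ-≡ₖ n (+-inverseˡ-≡ₖ m))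

  +-cancelˡ-≡ₖ : ∀ m {n n′} → m + n ≡ₖ m + n′ → n ≡ₖ n′
  +-cancelˡ-≡ₖ m {n} {n′} eq = begin
    n % k                   ≡⟨ neg-cancelˡ-≡ₖ m n ⟨
    (neg m + (m + n)) % k   ≡⟨ +-congˡ-≡ₖ (neg m) eq ⟩
    (neg m + (m + n′)) % k  ≡⟨ neg-cancelˡ-≡ₖ m n′ ⟩
    n′ % k                  ∎
    where open ≡-Reasoning

  inverse-unique-≡ₖ : ∀ {m n} → m + n ≡ₖ 0 → n ≡ₖ neg m
  inverse-unique-≡ₖ {m} {n} m+n≡0 = +-cancelˡ-≡ₖ m (trans m+n≡0 (sym (+-inverseʳ-≡ₖ m)))

  ≡ₖ⇒mod≡ : ∀ {m n} → m ≡ₖ n → m mod k ≡ n mod k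
  ≡ₖ⇒mod≡ eq = toℕ-injective (trans (toℕ-fromℕ< _) (trans eq (sym (toℕ-fromℕ< _))))

  toℕ-mod : ∀ x → toℕ x mod k ≡ x
  toℕ-mod x = toℕ-injective (trans (toℕ-fromℕ< _) (m<n⇒m%n≡m (toℕ<n x)))

  ≡ₖ⇒≡-mod : ∀ x {n} → toℕ x ≡ₖ n → x ≡ n mod k
  ≡ₖ⇒≡-mod x eq = trans (sym (toℕ-mod x)) (≡ₖ⇒mod≡ eq)

  toℕ-⊕ : ∀ s n → toℕ (s ⊕ n) ≡ₖ toℕ s + n
  toℕ-⊕ s n = trans (cong (_% k) (toℕ-fromℕ< _)) (%-≡ₖ (toℕ s + n))

  ⊕-cong : ∀ s {m n} → m ≡ₖ n → s ⊕ m ≡ s ⊕ n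
  ⊕-cong s eq = ≡ₖ⇒mod≡ (+-congˡ-≡ₖ (toℕ s) eq)

  ⊕-assoc : ∀ s m n → s ⊕ m ⊕ n ≡ s ⊕ (m + n)
  ⊕-assoc s m n = ≡ₖ⇒mod≡ (trans (+-congʳ-≡ₖ n (toℕ-⊕ s m)) (cong (_% k) (+-assoc (toℕ s) m n)))

  ⊕-identityʳ : ∀ s → s ⊕ 0 ≡ s
  ⊕-identityʳ s = trans (≡ₖ⇒mod≡ (cong (_% k) (+-identityʳ (toℕ s)))) (toℕ-mod s)

  ⊕-swap : ∀ s m n → s ⊕ m ⊕ n ≡ s ⊕ n ⊕ m
  ⊕-swap s m n = trans (⊕-assoc s m n) (trans (cong (s ⊕_) (+-comm m n)) (sym (⊕-assoc s n m)))

  ⊕-zero : ∀ s {n} → n ≡ₖ 0 → s ⊕ n ≡ s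
  ⊕-zero s n≡0 = trans (⊕-cong s n≡0) (⊕-identityʳ s)

  ⊕-inverseʳ : ∀ s n → s ⊕ n ⊕ neg n ≡ s
  ⊕-inverseʳ s n = trans (⊕-assoc s n (neg n)) (⊕-zero s (+-inverseʳ-≡ₖ n))

  ⊕-inverseˡ : ∀ s n → s ⊕ neg n ⊕ n ≡ s
  ⊕-inverseˡ s n = trans (⊕-assoc s (neg n) n) (⊕-zero s (+-inverseˡ-≡ₖ n))

  ⊕-cancelˡ : ∀ s {m n} → s ⊕ m ≡ s ⊕ n → m ≡ₖ n
  ⊕-cancelˡ s {m} {n} eq =
    +-cancelˡ-≡ₖ (toℕ s) (trans (sym (toℕ-⊕ s m)) (trans (cong (λ t → toℕ t % k) eq) (toℕ-⊕ s n)))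

  ⊕-fixed : ∀ s {n} → s ⊕ n ≡ s → n ≡ₖ 0
  ⊕-fixed s eq = ⊕-cancelˡ s (trans eq (sym (⊕-identityʳ s)))

  s⊕m⊕n≡s⇒n≡ₖneg[m] : ∀ s {m n} → s ⊕ m ⊕ n ≡ s → n ≡ₖ neg m
  s⊕m⊕n≡s⇒n≡ₖneg[m] s {m} {n} eq = inverse-unique-≡ₖ (⊕-fixed s (trans (sym (⊕-assoc s m n)) eq))

  ⊕-reach : ∀ s t → ∃ λ n → s ⊕ n ≡ t
  ⊕-reach s t = neg (toℕ s) + toℕ t , trans (≡ₖ⇒mod≡ cancel) (toℕ-mod t)
    where
      cancel : toℕ s + (neg (toℕ s) + toℕ t) ≡ₖ toℕ t
      cancel = trans (cong (_% k) (sym (+-assoc (toℕ s) _ _)))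
                     (+-identityˡ-≡ₖ (toℕ t) (+-inverseʳ-≡ₖ (toℕ s)))

  Touches : Fin k → ℕ → Fin k → Set
  Touches p v q = q ≡ p ⊎ q ⊕ v ≡ p

  touches-not-consecutive : ∀ {p v w} → w ≢ₖ 0 → v ≢ₖ w → v ≢ₖ neg w →
                            ∀ q → Touches p v q → ¬ Touches p v (q ⊕ w)
  touches-not-consecutive w≢0 v≢w v≢-w q (inj₁ q≡p) (inj₁ q⊕w≡p) = w≢0 (⊕-fixed q (trans q⊕w≡p (sym q≡p)))
  touches-not-consecutive w≢0 v≢w v≢-w q (inj₁ q≡p) (inj₂ q⊕w⊕v≡p) =
    v≢-w (s⊕m⊕n≡s⇒n≡ₖneg[m] q (trans q⊕w⊕v≡p (sym q≡p)))
  touches-not-consecutive w≢0 v≢w v≢-w q (inj₂ q⊕v≡p) (inj₁ q⊕w≡p) = v≢w (⊕-cancelˡ q (trans q⊕v≡p (sym q⊕w≡p)))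
  touches-not-consecutive {v = v} {w} w≢0 v≢w v≢-w q (inj₂ q⊕v≡p) (inj₂ q⊕w⊕v≡p) =
    w≢0 (⊕-fixed (q ⊕ v) (trans (⊕-swap q v w) (trans q⊕w⊕v≡p (sym q⊕v≡p))))

  m+m≡ₖ0⇒m%k+m%k≡k : ∀ {m} → m ≢ₖ 0 → m + m ≡ₖ 0 → m % k + m % k ≡ k
  m+m≡ₖ0⇒m%k+m%k≡k {m} m≢0 m+m≡0 with m % k + m % k <? k
  ... | yes r+r<k = contradiction (trans r≡0 (sym 0%k≡0)) m≢0
    where
      r = m % k
      [r+r]%k≡0 : (r + r) % k ≡ 0
      [r+r]%k≡0 = trans (sym (%-distribˡ-+ m m k)) (trans m+m≡0 0%k≡0)
      r≡0 : r ≡ 0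
      r≡0 = m+n≡0⇒m≡0 r (trans (sym (m<n⇒m%n≡m r+r<k)) [r+r]%k≡0)
  ... | no r+r≮k = ≤-antisym (m∸n≡0⇒m≤n excess≡0) (≮⇒≥ r+r≮k)
    where
      r = m % k
      excess = r + r ∸ k
      excess<k : excess < k
      excess<k = ≤-<-trans (≤-trans (∸-monoʳ-≤ (r + r) (<⇒≤ (m%n<n m k))) (≤-reflexive (m+n∸n≡m r r))) (m%n<n m k)
      excess≡0 : excess ≡ 0
      excess≡0 = begin
        excess              ≡⟨ m<n⇒m%n≡m excess<k ⟨
        excess % k          ≡⟨ [m+n]%n≡m%n excess k ⟨
        (excess + k) % k    ≡⟨ cong (_% k) (m∸n+n≡m (≮⇒≥ r+r≮k)) ⟩
        (r + r) % k         ≡⟨ %-distribˡ-+ m m k ⟨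
        (m + m) % k         ≡⟨ trans m+m≡0 0%k≡0 ⟩
        0                   ∎
        where open ≡-Reasoning

  ≡ₖneg-sym : ∀ {m n} → m ≡ₖ neg n → n ≡ₖ neg m
  ≡ₖneg-sym {m} {n} m≡-n = inverse-unique-≡ₖ (begin
    (m + n) % k      ≡⟨ cong (_% k) (+-comm m n) ⟩
    (n + m) % k      ≡⟨ +-congˡ-≡ₖ n m≡-n ⟩
    (n + neg n) % k  ≡⟨ +-inverseʳ-≡ₖ n ⟩
    0 % k            ∎)
    where open ≡-Reasoning

  m+m≢ₖ0⇒m≢ₖ0 : ∀ {w} → w + w ≢ₖ 0 → w ≢ₖ 0
  m+m≢ₖ0⇒m≢ₖ0 {w} 2w≢0 w≡0 = 2w≢0 (trans (+-identityˡ-≡ₖ w w≡0) w≡0)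

  m+m≡ₖ0-unique : ∀ {m n} → m ≢ₖ 0 → n ≢ₖ 0 → m + m ≡ₖ 0 → n + n ≡ₖ 0 → m ≡ₖ n
  m+m≡ₖ0-unique m≢0 n≢0 m+m≡0 n+n≡0 =
    x+x-injective (trans (m+m≡ₖ0⇒m%k+m%k≡k m≢0 m+m≡0) (sym (m+m≡ₖ0⇒m%k+m%k≡k n≢0 n+n≡0)))

  ≢⇒≢ₖ : ∀ x {n} → x ≢ n mod k → toℕ x ≢ₖ n
  ≢⇒≢ₖ x x≢n eq = x≢n (≡ₖ⇒≡-mod x eq)

  ≢0ₖ⇒0<toℕ : ∀ {a} → a ≢ 0ₖ → 0 < toℕ a
  ≢0ₖ⇒0<toℕ {a} a≢0 = n≢0⇒n>0 λ a≡0 → ≢⇒≢ₖ a a≢0 (cong (_% k) a≡0)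

  neg-toℕ : ∀ a → neg (toℕ a) mod k ≡ -ₖ a
  neg-toℕ a = cong (λ r → (k ∸ r) mod k) (m<n⇒m%n≡m (toℕ<n a))

  count-⊕ : ∀ (f : Fin k → Bool) n → count (λ s → f (s ⊕ n)) ≡ count f
  count-⊕ f n = sym (∑-permute (λ s → if f s then 1 else 0)
    (permutation (_⊕ n) (_⊕ neg n) (λ s → ⊕-inverseˡ s n) (λ s → ⊕-inverseʳ s n)))

  -- Escapes, almost periods and periods

  Escape Entry : (Fin k → Bool) → ℕ → Fin k → Set
  Escape P v s = P s ≡ true × P (s ⊕ v) ≡ false
  Entry P v s = P (s ⊕ v) ≡ true × P s ≡ false

  AlmostPeriod : (Fin k → Bool) → ℕ → Set
  AlmostPeriod P v = ∀ {s t} → Escape P v s → Escape P v t → s ≡ t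

  Closed Period : (Fin k → Bool) → ℕ → Set
  Closed P v = ∀ {s} → P s ≡ true → P (s ⊕ v) ≡ true
  Period P v = ∀ s → P (s ⊕ v) ≡ P s

  module _ (P : Fin k → Bool) where

    escape? : ∀ v → Dec (∃ (Escape P v))
    escape? v = any? λ s → (P s Bool.≟ true) ×-dec (P (s ⊕ v) Bool.≟ false)

    private
      escapes entries : ℕ → Fin k → Bool
      escapes v s = P s ∧ not (P (s ⊕ v))
      entries v s = P (s ⊕ v) ∧ not (P s)

      count-escapes≡count-entries : ∀ v → count (escapes v) ≡ count (entries v)
      count-escapes≡count-entries v = +-cancelˡ-≡ (count stay) _ _ (begin
        count stay + count (escapes v)                     ≡⟨ count-split P (P ∘ (_⊕ v)) ⟨
        count P                                            ≡⟨ count-⊕ P v ⟨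
        count (P ∘ (_⊕ v))                                 ≡⟨ count-split (P ∘ (_⊕ v)) P ⟩
        count (λ s → P (s ⊕ v) ∧ P s) + count (entries v)  ≡⟨ cong (_+ count (entries v)) swap ⟩
        count stay + count (entries v)                     ∎)
        where
          open ≡-Reasoning
          stay : Fin k → Bool
          stay s = P s ∧ P (s ⊕ v)
          swap = count-cong λ s → ∧-comm (P (s ⊕ v)) (P s)

      AlmostPeriod⇒AtMostOne : ∀ {v} → AlmostPeriod P v → AtMostOne (escapes v)
      AlmostPeriod⇒AtMostOne ap es et = ap (∧-not≡true⇒ es) (∧-not≡true⇒ et)

    almostPeriod? : ∀ v → Dec (AlmostPeriod P v)
    almostPeriod? v = map′
      (λ ≤1 (ps , psv) (pt , ptv) → count≤1⇒AtMostOne (escapes v) ≤1 (∧-not≡true ps psv) (∧-not≡true pt ptv))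
      (AtMostOne⇒count≤1 (escapes v) ∘ AlmostPeriod⇒AtMostOne)
      (count (escapes v) ≤? 1)

    entry-unique : ∀ {v} → AlmostPeriod P v → ∀ {s t} → Entry P v s → Entry P v t → s ≡ t
    entry-unique {v} ap (ps⊕v , ps) (pt⊕v , pt) =
      count≤1⇒AtMostOne (entries v) entries≤1 (∧-not≡true ps⊕v ps) (∧-not≡true pt⊕v pt)
      where
        entries≤1 = subst (_≤ 1) (count-escapes≡count-entries v)
                          (AtMostOne⇒count≤1 (escapes v) (AlmostPeriod⇒AtMostOne ap))

    closed⇒period : ∀ {v} → Closed P v → Period P v
    closed⇒period {v} closed s with P s in ps | P (s ⊕ v) in psv
    ... | true  | true  = refl
    ... | false | false = refl
    ... | true  | false = contradiction (trans (sym (closed ps)) psv) λ ()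
    ... | false | true  = contradiction (count-true (entries v) (∧-not≡true psv ps)) (<-irrefl (sym no-entries))
      where
        no-escape : ∀ s → escapes v s ≡ false
        no-escape s with P s in ps
        ... | false = refl
        ... | true rewrite closed ps = refl
        no-entries : count (entries v) ≡ 0
        no-entries = trans (sym (count-escapes≡count-entries v)) (count-false (escapes v) no-escape)

    escape-free⇒period : ∀ {v} → ¬ ∃ (Escape P v) → Period P v
    escape-free⇒period {v} none = closed⇒period closed
      where
        closed : Closed P v
        closed {s} ps with P (s ⊕ v) in ps⊕v
        ... | true  = refl
        ... | false = contradiction (s , ps , ps⊕v) none

    period? : ∀ n → Dec (Period P n)
    period? n = all? λ s → P (s ⊕ n) Bool.≟ P s

    period-0 : Period P 0
    period-0 s = cong P (⊕-identityʳ s)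

    period-+ : ∀ {m n} → Period P m → Period P n → Period P (m + n)
    period-+ {m} {n} pm pn s = trans (cong P (sym (⊕-assoc s m n))) (trans (pn (s ⊕ m)) (pm s))

    period-* : ∀ j {n} → Period P n → Period P (j * n)
    period-* zero _ = period-0
    period-* (suc j) pn = period-+ pn (period-* j pn)

    period-+⁻¹ˡ : ∀ {m n} → Period P (m + n) → Period P n → Period P m
    period-+⁻¹ˡ {m} {n} pm+n pn s = begin
      P (s ⊕ m)        ≡⟨ pn (s ⊕ m) ⟨
      P (s ⊕ m ⊕ n)    ≡⟨ cong P (⊕-assoc s m n) ⟩
      P (s ⊕ (m + n))  ≡⟨ pm+n s ⟩
      P s              ∎
      where open ≡-Reasoning

    period-cong : ∀ {m n} → m ≡ₖ n → Period P m → Period P n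
    period-cong m≡n pm s = trans (cong P (⊕-cong s (sym m≡n))) (pm s)

    period-neg : ∀ {n} → Period P n → Period P (neg n)
    period-neg {n} pn s = trans (sym (pn (s ⊕ neg n))) (cong P (⊕-inverseˡ s n))

    period-k : Period P k
    period-k = period-cong (trans 0%k≡0 (sym (n%n≡0 k))) period-0

    period-1⇒constant : Period P 1 → ∀ s t → P s ≡ P t
    period-1⇒constant p1 s t with ⊕-reach s t
    ... | n , s⊕n≡t = sym (trans (cong P (sym s⊕n≡t)) (pn s))
      where
        pn : Period P n
        pn = period-cong (cong (_% k) (*-identityʳ n)) (period-* n p1)

    escape-⊕-period : ∀ {n v s} → Period P n → Escape P v s → Escape P v (s ⊕ n)
    escape-⊕-period {n} {v} {s} pn (ps , psv) =
      trans (pn s) ps , trans (cong P (⊕-swap s n v)) (trans (pn (s ⊕ v)) psv)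

    escape⇒≢ₖ0 : ∀ {w e} → Escape P w e → w ≢ₖ 0
    escape⇒≢ₖ0 {e = e} (pe , pew) w≡0 = contradiction (trans (sym pew) (trans (cong P (⊕-zero e w≡0)) pe)) λ ()

    period-of-escaping⇒≡ₖ0 : ∀ {w e v} → AlmostPeriod P w → Escape P w e → Period P v → v ≡ₖ 0
    period-of-escaping⇒≡ₖ0 {e = e} apw esc pv = ⊕-fixed e (apw (escape-⊕-period pv esc) esc)

  least-period-∣ : ∀ (X : Fin k → Bool) {m} → 0 < m → Period X m →
                   (∀ {j} → j < m → ¬ (0 < j × Period X j)) → ∀ {n} → Period X n → m ∣ n
  least-period-∣ X {m} 0<m pm minimal {n} pn = m%n≡0⇒n∣m n m r≡0
    where
      instance _ = >-nonZero 0<m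
      pr : Period X (n % m)
      pr = period-+⁻¹ˡ X (subst (Period X) (m≡m%n+[m/n]*n n m) pn) (period-* X (n / m) pm)
      r≡0 : n % m ≡ 0
      r≡0 with n % m ℕ.≟ 0
      ... | yes r≡0 = r≡0
      ... | no r≢0 = contradiction (n≢0⇒n>0 r≢0 , pr) (minimal (m%n<n n m))

  -- One-point modifications

  module _ (P : Fin k → Bool) where

    -- The w-progression of P ending at the escape e is the single point e,
    -- or the gap after it is the single point e ⊕ w.
    isolated-or-gap : ∀ {w e v} → AlmostPeriod P w → Escape P w e → AlmostPeriod P v →
                      v ≢ₖ 0 → v ≢ₖ w → v ≢ₖ neg w →
                      P (e ⊕ neg w) ≡ false ⊎ P (e ⊕ w ⊕ w) ≡ true
    isolated-or-gap {w} {e} {v} apw esc apv v≢0 v≢w v≢-w with escape? P v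
    ... | no none = contradiction
          (period-of-escaping⇒≡ₖ0 P apw esc (escape-free⇒period P none)) v≢0
    ... | yes (s , ps , psv) = combine after before
      where
        w≢0 = escape⇒≢ₖ0 P esc
        u = s ⊕ neg w
        u⊕w≡s : u ⊕ w ≡ s
        u⊕w≡s = ⊕-inverseˡ s w

        after : s ≡ e ⊎ P (s ⊕ v ⊕ w) ≡ true
        after with s ≟ e | P (s ⊕ w) in psw | P (s ⊕ v ⊕ w) in psvw
        ... | yes s≡e | _     | _     = inj₁ s≡e
        ... | no s≢e  | false | _     = contradiction (apw (ps , psw) esc) s≢e
        ... | no _    | true  | true  = inj₂ refl
        ... | no _    | true  | false = contradiction
              (⊕-fixed s (apv (psw , trans (cong P (⊕-swap s w v)) psvw) (ps , psv))) w≢0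

        before : P u ≡ false ⊎ u ⊕ v ≡ e
        before with P u in pu | P (u ⊕ v) in puv
        ... | false | _     = inj₁ refl
        ... | true  | true  = inj₂ (apw (puv , trans (cong P (trans (⊕-swap u v w) (cong (_⊕ v) u⊕w≡s))) psv) esc)
        ... | true  | false = contradiction
              (⊕-fixed s (trans (cong (_⊕ w) (sym (apv (pu , puv) (ps , psv)))) u⊕w≡s)) w≢0

        combine : s ≡ e ⊎ P (s ⊕ v ⊕ w) ≡ true → P u ≡ false ⊎ u ⊕ v ≡ e →
                  P (e ⊕ neg w) ≡ false ⊎ P (e ⊕ w ⊕ w) ≡ true
        combine (inj₁ refl) (inj₁ pu)    = inj₁ pu
        combine (inj₁ refl) (inj₂ u⊕v≡s) = contradiction (⊕-cancelˡ u (trans u⊕v≡s (sym u⊕w≡s))) v≢w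
        combine (inj₂ psvw) (inj₁ pu)    = contradiction
          (⊕-cancelˡ s (entry-unique P apw (psvw , psv) (trans (cong P u⊕w≡s) ps , pu))) v≢-w
        combine (inj₂ psvw) (inj₂ u⊕v≡e) = inj₂ (subst (λ t → P (t ⊕ w) ≡ true) s⊕v≡e⊕w psvw)
          where
            s⊕v≡e⊕w : s ⊕ v ≡ e ⊕ w
            s⊕v≡e⊕w = trans (cong (_⊕ v) (sym u⊕w≡s)) (trans (⊕-swap u w v) (cong (_⊕ w) u⊕v≡e))

    -- An escape q of X under v moves along the w-orbit. Unless {q, q ⊕ v} touches p, it is also
    -- an escape of P; this never happens twice in a row, so two distinct orbit points are escapes of P.
    modification-closed : ∀ {X p w v} → (∀ {s} → s ≢ p → X s ≡ P s) → Period X w → w + w ≢ₖ 0 →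
                          AlmostPeriod P v → v ≢ₖ w → v ≢ₖ neg w → Closed X v
    modification-closed {X} {p} {w} {v} agree pw 2w≢0 apv v≢w v≢-w {s} xs with X (s ⊕ v) in xsv
    ... | true = refl
    ... | false = ⊥-elim two-escapes
      where
        w≢0 = m+m≢ₖ0⇒m≢ₖ0 2w≢0
        apart = touches-not-consecutive w≢0 v≢w v≢-w
        esc : Escape X v s
        esc = xs , xsv
        esc⊕w = escape-⊕-period X pw esc

        coincide : ∀ {q r} → Escape X v q → Escape X v r → ¬ Touches p v q → ¬ Touches p v r → q ≡ r
        coincide eq er ¬tq ¬tr = apv (escape-of-P eq ¬tq) (escape-of-P er ¬tr)
          where
            escape-of-P : ∀ {q} → Escape X v q → ¬ Touches p v q → Escape P v q
            escape-of-P (xq , xqv) ¬tq = trans (sym (agree (¬tq ∘ inj₁))) xq , trans (sym (agree (¬tq ∘ inj₂))) xqv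

        two-escapes : ⊥
        two-escapes with (s ≟ p) ⊎-dec (s ⊕ v ≟ p) | (s ⊕ w ≟ p) ⊎-dec (s ⊕ w ⊕ v ≟ p)
        ... | no ¬ts | no ¬ts⊕w = w≢0 (⊕-fixed s (sym (coincide esc esc⊕w ¬ts ¬ts⊕w)))
        ... | no ¬ts | yes ts⊕w = 2w≢0 (⊕-fixed s (trans (sym (⊕-assoc s w w))
          (sym (coincide esc (escape-⊕-period X pw esc⊕w) ¬ts (apart (s ⊕ w) ts⊕w)))))
        ... | yes ts | _ = 2w≢0 (⊕-fixed s (sym (begin
          s              ≡⟨ ⊕-inverseˡ s w ⟨
          s ⊕ neg w ⊕ w  ≡⟨ cong (_⊕ w) (coincide esc⊖w esc⊕w ¬ts⊖w (apart s ts)) ⟩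
          s ⊕ w ⊕ w      ≡⟨ ⊕-assoc s w w ⟩
          s ⊕ (w + w)    ∎)))
          where
            open ≡-Reasoning
            esc⊖w = escape-⊕-period X (period-neg X pw) esc
            ¬ts⊖w : ¬ Touches p v (s ⊕ neg w)
            ¬ts⊖w ts⊖w = apart (s ⊕ neg w) ts⊖w (subst (Touches p v) (sym (⊕-inverseˡ s w)) ts)

    modification-period : ∀ {X p w} → (∀ {s} → s ≢ p → X s ≡ P s) → Period X w → w + w ≢ₖ 0 →
                          ∀ {v} → AlmostPeriod P v → Period X v
    modification-period {X} {w = w} agree pw 2w≢0 {v} apv with v % k ℕ.≟ w % k | v % k ℕ.≟ neg w % k
    ... | yes v≡w | _        = period-cong X (sym v≡w) pw
    ... | no _    | yes v≡-w = period-cong X (sym v≡-w) (period-neg X pw)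
    ... | no v≢w  | no v≢-w  = closed⇒period X (modification-closed agree pw 2w≢0 apv v≢w v≢-w)

    removal-closed : ∀ {w e} → AlmostPeriod P w → Escape P w e → P (e ⊕ neg w) ≡ false →
                     Closed (updateAt P e λ _ → false) w
    removal-closed {w} {e} apw esc isolated {s} xs = trans (updateAt-minimal (s ⊕ w) e P s⊕w≢e) ps⊕w
      where
        s≢e : s ≢ e
        s≢e s≡e = contradiction
          (trans (sym xs) (trans (cong (updateAt P e λ _ → false) s≡e) (updateAt-updates e P))) λ ()
        ps : P s ≡ true
        ps = trans (sym (updateAt-minimal s e P s≢e)) xs
        ps⊕w : P (s ⊕ w) ≡ true
        ps⊕w with P (s ⊕ w) in ps⊕w
        ... | true  = refl
        ... | false = contradiction (apw (ps , ps⊕w) esc) s≢e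
        s⊕w≢e : s ⊕ w ≢ e
        s⊕w≢e s⊕w≡e = contradiction
          (trans (sym ps) (trans (cong P (trans (sym (⊕-inverseʳ s w)) (cong (_⊕ neg w) s⊕w≡e))) isolated)) λ ()

    filling-closed : ∀ {w e} → AlmostPeriod P w → Escape P w e → P (e ⊕ w ⊕ w) ≡ true →
                     Closed (updateAt P (e ⊕ w) λ _ → true) w
    filling-closed {w} {e} apw esc gap {s} xs with s ⊕ w ≟ e ⊕ w
    ... | yes s⊕w≡e⊕w = trans (cong (updateAt P (e ⊕ w) λ _ → true) s⊕w≡e⊕w) (updateAt-updates (e ⊕ w) P)
    ... | no s⊕w≢e⊕w = trans (updateAt-minimal (s ⊕ w) (e ⊕ w) P s⊕w≢e⊕w) ps⊕w
      where
        ps⊕w : P (s ⊕ w) ≡ true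
        ps⊕w with s ≟ e ⊕ w
        ... | yes s≡e⊕w = subst (λ t → P (t ⊕ w) ≡ true) (sym s≡e⊕w) gap
        ... | no s≢e⊕w with P (s ⊕ w) in ps⊕w
        ...   | true  = refl
        ...   | false = contradiction
                (cong (_⊕ w) (apw (trans (sym (updateAt-minimal s (e ⊕ w) P s≢e⊕w)) xs , ps⊕w) esc)) s⊕w≢e⊕w

    record InvariantProperSubset : Set where
      field
        X : Fin k → Bool
        member : ∃ λ t → X t ≡ true
        nonmember : ∃ λ t → X t ≡ false
        invariant : ∀ {v} → AlmostPeriod P v → Period X v

    one-point-modification : ∀ {w e v} → 2 ≤ count P → 2 ≤ count (not ∘ P) →
      AlmostPeriod P w → Escape P w e → w + w ≢ₖ 0 →
      AlmostPeriod P v → v ≢ₖ 0 → v ≢ₖ w → v ≢ₖ neg w → InvariantProperSubset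
    one-point-modification {w} {e} 2≤|P| 2≤|∁P| apw esc 2w≢0 apv v≢0 v≢w v≢-w
      with isolated-or-gap apw esc apv v≢0 v≢w v≢-w
    ... | inj₁ isolated = record
      { X = updateAt P e λ _ → false
      ; member = let t , t≢e , pt = 2≤count⇒other P 2≤|P| e in t , trans (updateAt-minimal t e P t≢e) pt
      ; nonmember = e , updateAt-updates e P
      ; invariant = modification-period (updateAt-minimal _ e P)
                      (closed⇒period _ (removal-closed apw esc isolated)) 2w≢0
      }
    ... | inj₂ gap = record
      { X = updateAt P (e ⊕ w) λ _ → true
      ; member = e ⊕ w , updateAt-updates (e ⊕ w) P
      ; nonmember = let t , t≢e⊕w , ¬pt = 2≤count⇒other (not ∘ P) 2≤|∁P| (e ⊕ w)
                    in t , trans (updateAt-minimal t (e ⊕ w) P t≢e⊕w) (not≡true⇒≡false ¬pt)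
      ; invariant = modification-period (updateAt-minimal _ (e ⊕ w) P)
                      (closed⇒period _ (filling-closed apw esc gap)) 2w≢0
      }

    -- Two distinct nonzero elements cannot both have order 2, so a or y can play the role of w.
    invariant-proper-subset : ∀ {a y} → 2 ≤ count P → 2 ≤ count (not ∘ P) →
      AlmostPeriod P a → a ≢ₖ 0 → AlmostPeriod P y → y ≢ₖ 0 → y ≢ₖ a → y ≢ₖ neg a →
      InvariantProperSubset
    invariant-proper-subset {a} {y} 2≤|P| 2≤|∁P| apa a≢0 apy y≢0 y≢a y≢-a
      with escape? P a | (a + a) % k ℕ.≟ 0 % k
    ... | no none | _ = record
      { X = P
      ; member = let t , _ , pt = 2≤count⇒other P 2≤|P| (0 mod k) in t , pt
      ; nonmember = let t , _ , ¬pt = 2≤count⇒other (not ∘ P) 2≤|∁P| (0 mod k)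
                    in t , not≡true⇒≡false ¬pt
      ; invariant = invariant
      }
      where
        pa : Period P a
        pa = escape-free⇒period P none
        invariant : ∀ {v} → AlmostPeriod P v → Period P v
        invariant {v} apv with escape? P v
        ... | no none′ = escape-free⇒period P none′
        ... | yes (_ , esc) = contradiction (period-of-escaping⇒≡ₖ0 P apv esc pa) a≢0
    ... | yes (_ , esc) | no 2a≢0 = one-point-modification 2≤|P| 2≤|∁P| apa esc 2a≢0 apy y≢0 y≢a y≢-a
    ... | yes (_ , esc) | yes 2a≡0 with escape? P y | (y + y) % k ℕ.≟ 0 % k
    ...   | no none | _ = contradiction
            (period-of-escaping⇒≡ₖ0 P apa esc (escape-free⇒period P none)) y≢0
    ...   | yes (_ , esc′) | no 2y≢0 =
            one-point-modification 2≤|P| 2≤|∁P| apy esc′ 2y≢0 apa a≢0 (y≢a ∘ sym) (y≢-a ∘ ≡ₖneg-sym)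
    ...   | yes _ | yes 2y≡0 = contradiction (m+m≡ₖ0-unique y≢0 a≢0 2y≡0 2a≡0) y≢a

    proper-divisor : InvariantProperSubset → ∀ {a} → AlmostPeriod P a → 0 < a → a < k →
                     Σ ℕ λ d → 1 < d × d < k × d ∣ k × (∀ {v} → AlmostPeriod P v → d ∣ v)
    proper-divisor record { X = X ; member = t , xt ; nonmember = u , xu ; invariant = invariant }
                   {a} apa 0<a a<k with minimal-witness (λ n → (0 <? n) ×-dec period? X n) (0<a , invariant apa)
    ... | m , (0<m , pm) , minimal = m , 1<m , ≤-<-trans m≤a a<k , m∣ (period-k X) , m∣ ∘ invariant
      where
        m∣ = least-period-∣ X 0<m pm minimal
        m≤a : m ≤ a
        m≤a = ≮⇒≥ λ a<m → minimal a<m (0<a , invariant apa)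
        1<m : 1 < m
        1<m = ≤∧≢⇒< 0<m λ 1≡m → contradiction
          (trans (sym xt) (trans (period-1⇒constant X (subst (Period X) (sym 1≡m) pm) t u) xu)) λ ()

  -- The two alternatives

  CommonProperDivisor InUnitProgression : (Fin k → Set) → Set
  CommonProperDivisor Q = Σ ℕ λ d → 1 < d × d < k × d ∣ k × (∀ x → Q x → d ∣ toℕ x)
  InUnitProgression Q = Σ (Fin k) λ a → gcd (toℕ a) k ≡ 1 × (∀ x → Q x → x ≡ 0ₖ ⊎ x ≡ a ⊎ x ≡ -ₖ a)

  gcd-alternative : ∀ {Q : Fin k → Set} a → a ≢ 0ₖ → (∀ x → Q x → x ≡ 0ₖ ⊎ x ≡ a ⊎ x ≡ -ₖ a) →
                    CommonProperDivisor Q ⊎ InUnitProgression Q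
  gcd-alternative a a≢0 within with gcd (toℕ a) k ℕ.≟ 1
  ... | yes coprime = inj₂ (a , coprime , within)
  ... | no g≢1 = inj₁ (g , 1<g , g<k , g∣k , λ x qx → g∣ (within x qx))
    where
      g = gcd (toℕ a) k
      g∣a = gcd[m,n]∣m (toℕ a) k
      g∣k = gcd[m,n]∣n (toℕ a) k
      1<g : 1 < g
      1<g = ≤∧≢⇒< (n≢0⇒n>0 λ g≡0 → ≢-nonZero⁻¹ k (gcd[m,n]≡0⇒n≡0 (toℕ a) g≡0)) (g≢1 ∘ sym)
      g<k : g < k
      g<k = ≤-<-trans (∣⇒≤ {{>-nonZero (≢0ₖ⇒0<toℕ a≢0)}} g∣a) (toℕ<n a)
      g∣mod : ∀ {n} → g ∣ n → g ∣ toℕ (n mod k)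
      g∣mod g∣n = subst (g ∣_) (sym (toℕ-fromℕ< _)) (%-presˡ-∣ g∣n g∣k)
      g∣ : ∀ {x} → x ≡ 0ₖ ⊎ x ≡ a ⊎ x ≡ -ₖ a → g ∣ toℕ x
      g∣ (inj₁ refl) = g∣mod (g ∣0)
      g∣ (inj₂ (inj₁ refl)) = g∣a
      g∣ (inj₂ (inj₂ refl)) = g∣mod (∣m+n∣m⇒∣n (subst (g ∣_) (sym (m+[n∸m]≡n (<⇒≤ (toℕ<n a)))) g∣k) g∣a)

  dichotomy : (P : Fin k → Bool) → 2 ≤ count P → 2 ≤ count (not ∘ P) →
              ∀ a → a ≢ 0ₖ → AlmostPeriod P (toℕ a) →
              CommonProperDivisor (AlmostPeriod P ∘ toℕ) ⊎ InUnitProgression (AlmostPeriod P ∘ toℕ)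
  dichotomy P 2≤|P| 2≤|∁P| a a≢0 apa
    with any? {P = λ y → AlmostPeriod P (toℕ y) × y ≢ 0ₖ × y ≢ a × y ≢ -ₖ a}
              (λ y → almostPeriod? P (toℕ y) ×-dec ¬? (y ≟ 0ₖ) ×-dec ¬? (y ≟ a) ×-dec ¬? (y ≟ -ₖ a))
  ... | yes (y , apy , y≢0 , y≢a , y≢-a) =
    let d , 1<d , d<k , d∣k , d∣ = proper-divisor P
          (invariant-proper-subset P 2≤|P| 2≤|∁P| apa (≢⇒≢ₖ a a≢0) apy (≢⇒≢ₖ y y≢0)
            (≢⇒≢ₖ y (y≢a ∘ (λ y≡ → trans y≡ (toℕ-mod a)))) (≢⇒≢ₖ y (y≢-a ∘ λ y≡ → trans y≡ (neg-toℕ a))))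
          apa (≢0ₖ⇒0<toℕ a≢0) (toℕ<n a)
    in inj₁ (d , 1<d , d<k , d∣k , λ _ → d∣)
  ... | no none = gcd-alternative a a≢0 classify
    where
      classify : ∀ x → AlmostPeriod P (toℕ x) → x ≡ 0ₖ ⊎ x ≡ a ⊎ x ≡ -ₖ a
      classify x apx with x ≟ 0ₖ | x ≟ a | x ≟ -ₖ a
      ... | yes x≡0 | _       | _        = inj₁ x≡0
      ... | no _    | yes x≡a | _        = inj₂ (inj₁ x≡a)
      ... | no _    | no _    | yes x≡-a = inj₂ (inj₂ x≡-a)
      ... | no x≢0  | no x≢a  | no x≢-a  = ⊥-elim (none (x , apx , x≢0 , x≢a , x≢-a))

  translate⇒almostPeriod : ∀ {A A′ : Subset k} {x} → A′ ⊆ A → suc ∣ A′ ∣ ≡ ∣ A ∣ →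
                           TranslateInto A′ x A → AlmostPeriod (lookup A) (toℕ x)
  translate⇒almostPeriod {A} {A′} {x} A′⊆A |A′|+1≡|A| A′+x⊆A {s} {t} (ps , ps⊕x) (pt , pt⊕x) with s ≟ t
  ... | yes s≡t = s≡t
  ... | no s≢t = contradiction |A′|+1≡|A|
    (<⇒≢ (≤-<-trans (p⊂q⇒∣p∣<∣q∣ A′⊂A-s) (x∈p⇒∣p-x∣<∣p∣ (lookup⇒[]= s A ps))))
    where
      escaped : ∀ {u} → lookup A (u ⊕ toℕ x) ≡ false → u ∉ A′
      escaped pu⊕x u∈A′ = contradiction (trans (sym ([]=⇒lookup (A′+x⊆A u∈A′))) pu⊕x) λ ()
      A′⊂A-s : A′ ⊂ A - s
      A′⊂A-s = (λ {u} u∈A′ → x∈p∧x≢y⇒x∈p-y (A′⊆A u∈A′) λ u≡s → escaped ps⊕x (subst (_∈ A′) u≡s u∈A′))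
             , t , x∈p∧x≢y⇒x∈p-y (lookup⇒[]= t A pt) (s≢t ∘ sym) , escaped pt⊕x

lemma1 : (k : ℕ) .{{_ : NonZero k}} → 2 ≤ k → (A : Subset k) → NearAP A →
    (Σ ℕ λ d → 1 < d × d < k × d ∣ k ×
       ((A′ : Subset k) → A′ ⊆ A → suc ∣ A′ ∣ ≡ ∣ A ∣ →
          (x : Fin k) → TranslateInto A′ x A → d ∣ toℕ x))
    ⊎
    (Σ (Fin k) λ a → gcd (toℕ a) k ≡ 1 ×
       ((A′ : Subset k) → A′ ⊆ A → suc ∣ A′ ∣ ≡ ∣ A ∣ →
          (x : Fin k) → TranslateInto A′ x A →
          (x ≡ 0ₖ ⊎ x ≡ a ⊎ x ≡ -ₖ a)))
lemma1 k _ A (2≤|A| , |A|+2≤k , B , a , B⊆A , |B|+1≡|A| , a≢0 , B+a⊆A) =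
  Sum.map (λ (d , 1<d , d<k , d∣k , d∣) → d , 1<d , d<k , d∣k , λ _ sub eq x tr → d∣ x (almost-period sub eq tr))
          (λ (b , coprime , within) → b , coprime , λ _ sub eq x tr → within x (almost-period sub eq tr))
          (dichotomy (lookup A) 2≤|P| 2≤|∁P| a a≢0 (almost-period B⊆A |B|+1≡|A| B+a⊆A))
  where
    almost-period = translate⇒almostPeriod {A = A}
    2≤|P| : 2 ≤ count (lookup A)
    2≤|P| = subst (2 ≤_) (sym (count-lookup A)) 2≤|A|
    2≤|∁P| : 2 ≤ count (not ∘ lookup A)
    2≤|∁P| = subst (2 ≤_) (sym (count-∁ A)) (m+n≤o⇒m≤o∸n 2 |A|+2≤k)
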